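{- Let $k\ge2$, let $p\in S_k$ be a permutation in which the letter $1$ is immediately followed by the letter $k$, and let $j=p^{ -1}(1)$ (so that $p^{ -1}(1)=j$, $p^{ -1}(k)=j+1$, i.e. $p^{ -1}$ has the form $j\cdots(j+1)$). A permutation $\pi\in S_n$ avoids $p$ with Bruhat restriction $[j,j+1]$ if and only if $\pi^{ -1}$ avoids $p^{ -1}$ with Bruhat restriction $[1,k]$.
   Context: For $\pi\in S_n$ and $i<j$, $\pi[i,j]$ covers $\pi$ (in Bruhat order) if $\pi(i)<\pi(j)$ and there is no $t$ with $i<t<j$ and $\pi(i)<\pi(t)<\pi(j)$. Given a pattern $p\in S_k$ and $a<b$ in $\{1,\dots,k\}$, $\pi$ contains $p$ with Bruhat restriction $[a,b]$ if there is an occurrence of $p$ in $\pi$ at positions $i_1<\dots<i_k$ (letters in the same relative order as $p$) such that $\pi(i_a)<\pi(i_b)$ and no $t$ with $i_a<t<i_b$ has $\pi(i_a)<\pi(t)<\pi(i_b)$; otherwise $\pi$ avoids it. -}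

module Defs where

open import Data.Nat using (ℕ)
open import Data.Fin using (Fin; _<_)
open import Data.Fin.Permutation using (Permutation′; _⟨$⟩ʳ_)
open import Data.Product using (Σ; _×_)
open import Function.Bundles using (_⇔_)
open import Relation.Nullary using (¬_)

-- A permutation in S_n is a bijection Fin n → Fin n; π(i) is  π ⟨$⟩ʳ i,
-- its inverse is  Data.Fin.Permutation.flip π.  Letters/positions are
-- 0-indexed (Fin n), so the letter "1" is 0 and the letter "k" is k-1.

record Occurrence {k n : ℕ} (p : Permutation′ k) (π : Permutation′ n) : Set where
  field
    ι        : Fin k → Fin n
    increasing : ∀ a b → a < b → ι a < ι b
    sameOrder  : ∀ a b → (p ⟨$⟩ʳ a < p ⟨$⟩ʳ b) ⇔ (π ⟨$⟩ʳ ι a < π ⟨$⟩ʳ ι b)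

-- π[i,j] covers π in Bruhat order
BruhatCover : {n : ℕ} → Permutation′ n → Fin n → Fin n → Set
BruhatCover π i j =
  (π ⟨$⟩ʳ i < π ⟨$⟩ʳ j) ×
  ¬ (Σ (Fin _) λ t → (i < t) × (t < j) × (π ⟨$⟩ʳ i < π ⟨$⟩ʳ t) × (π ⟨$⟩ʳ t < π ⟨$⟩ʳ j))

ContainsBR : {k n : ℕ} → Permutation′ k → Fin k → Fin k → Permutation′ n → Set
ContainsBR p a b π =
  Σ (Occurrence p π) λ occ → BruhatCover π (Occurrence.ι occ a) (Occurrence.ι occ b)

AvoidsBR : {k n : ℕ} → Permutation′ k → Fin k → Fin k → Permutation′ n → Set
AvoidsBR p a b π = ¬ ContainsBR p a b π

-- An occurrence of p in π at positions ι becomes an occurrence of p⁻¹ in π⁻¹ at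
-- positions x ↦ π(ι(p⁻¹ x)): inverting transposes the plot of π, which swaps the
-- roles of positions and values.  The Bruhat condition at positions i < j asks
-- that the rectangle spanned by the points (i, π i) and (j, π j) contain no
-- point of the plot, and this is invariant under transposition.  Since p⁻¹
-- sends 1 and k to j and j + 1, the restriction [j, j+1] for p corresponds to
-- the restriction [1, k] for p⁻¹.
module Submission where

open import Defs
open import Data.Nat using (ℕ; _≤_; _∸_)
import Data.Nat as ℕ
open import Data.Nat.Properties using (n<1+n; m<n⇒0<n∸m)
open import Data.Fin using (Fin; toℕ; _<_)
open import Data.Fin.Properties using (<-cmp; <-irrefl; <-asym)
open import Data.Fin.Permutation using (Permutation′; _⟨$⟩ʳ_; _⟨$⟩ˡ_; flip; inverseˡ; inverseʳ)
open import Data.Product using (Σ; _×_; _,_)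
open import Data.Empty using (⊥-elim)
open import Function.Bundles using (_⇔_; mk⇔; module Equivalence)
open import Relation.Binary using (tri<; tri≈; tri>)
open import Relation.Binary.PropositionalEquality using (_≡_; refl; sym; trans; cong; subst; subst₂)
open import Relation.Nullary using (¬_; contraposition)

strictlyIncreasing⇒reflects-< : ∀ {k n} (ι : Fin k → Fin n) →
  (∀ a b → a < b → ι a < ι b) → ∀ a b → ι a < ι b → a < b
strictlyIncreasing⇒reflects-< ι increasing a b ιa<ιb with <-cmp a b
... | tri< a<b _ _    = a<b
... | tri≈ _ refl _   = ⊥-elim (<-irrefl refl ιa<ιb)
... | tri> _ _ b<a    = ⊥-elim (<-asym ιa<ιb (increasing b a b<a))

occurrence-flip : ∀ {k n} (p : Permutation′ k) (π : Permutation′ n) →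
  Occurrence p π → Occurrence (flip p) (flip π)
occurrence-flip {k} {n} p π occ = record
  { ι          = ι′
  ; increasing = increasing′
  ; sameOrder  = sameOrder′
  }
  where
  open Occurrence occ

  ι′ : Fin k → Fin n
  ι′ x = π ⟨$⟩ʳ ι (p ⟨$⟩ˡ x)

  flip-ι′ : ∀ x → π ⟨$⟩ˡ ι′ x ≡ ι (p ⟨$⟩ˡ x)
  flip-ι′ x = inverseˡ π

  increasing′ : ∀ x y → x < y → ι′ x < ι′ y
  increasing′ x y x<y = Equivalence.to (sameOrder (p ⟨$⟩ˡ x) (p ⟨$⟩ˡ y))
    (subst₂ _<_ (sym (inverseʳ p)) (sym (inverseʳ p)) x<y)

  sameOrder′ : ∀ x y → (p ⟨$⟩ˡ x < p ⟨$⟩ˡ y) ⇔ (π ⟨$⟩ˡ ι′ x < π ⟨$⟩ˡ ι′ y)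
  sameOrder′ x y = mk⇔
    (λ lt → subst₂ _<_ (sym (flip-ι′ x)) (sym (flip-ι′ y)) (increasing _ _ lt))
    (λ lt → strictlyIncreasing⇒reflects-< ι increasing _ _
              (subst₂ _<_ (flip-ι′ x) (flip-ι′ y) lt))

bruhatCover-flip : ∀ {n} (π : Permutation′ n) {i j : Fin n} → i < j →
  BruhatCover π i j → BruhatCover (flip π) (π ⟨$⟩ʳ i) (π ⟨$⟩ʳ j)
bruhatCover-flip {n} π {i} {j} i<j (_ , emptyRectangle) =
  subst₂ _<_ (sym (inverseˡ π)) (sym (inverseˡ π)) i<j , emptyRectangle′
  where
  emptyRectangle′ : ¬ Σ (Fin n) λ t → (π ⟨$⟩ʳ i < t) × (t < π ⟨$⟩ʳ j)
                           × (π ⟨$⟩ˡ (π ⟨$⟩ʳ i) < π ⟨$⟩ˡ t) × (π ⟨$⟩ˡ t < π ⟨$⟩ˡ (π ⟨$⟩ʳ j))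
  emptyRectangle′ (t , πi<t , t<πj , π⁻¹πi<π⁻¹t , π⁻¹t<π⁻¹πj) = emptyRectangle
    ( π ⟨$⟩ˡ t
    , subst₂ _<_ (inverseˡ π) refl π⁻¹πi<π⁻¹t
    , subst₂ _<_ refl (inverseˡ π) π⁻¹t<π⁻¹πj
    , subst₂ _<_ refl (sym (inverseʳ π)) πi<t
    , subst₂ _<_ (sym (inverseʳ π)) refl t<πj
    )

containsBR-flip : ∀ {k n} (p : Permutation′ k) (π : Permutation′ n) {a b : Fin k} → a < b →
  ContainsBR p a b π → ContainsBR (flip p) (p ⟨$⟩ʳ a) (p ⟨$⟩ʳ b) (flip π)
containsBR-flip p π {a} {b} a<b (occ , cover) =
  occurrence-flip p π occ ,
  subst₂ (BruhatCover (flip π)) (position a) (position b)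
    (bruhatCover-flip π (increasing a b a<b) cover)
  where
  open Occurrence occ
  position : ∀ c → π ⟨$⟩ʳ ι c ≡ π ⟨$⟩ʳ ι (p ⟨$⟩ˡ (p ⟨$⟩ʳ c))
  position c = cong (λ x → π ⟨$⟩ʳ ι x) (sym (inverseˡ p))

corollary2 : (k : ℕ) → 2 ≤ k → (p : Permutation′ k)
    → (one kk : Fin k) → toℕ one ≡ 0 → toℕ kk ≡ k ∸ 1
    → (j j′ : Fin k) → toℕ j′ ≡ Data.Nat.suc (toℕ j)
    → p ⟨$⟩ʳ j ≡ one → p ⟨$⟩ʳ j′ ≡ kk
    → (n : ℕ) → (π : Permutation′ n)
    → AvoidsBR p j j′ π ⇔ AvoidsBR (flip p) one kk (flip π)
corollary2 k 2≤k p one kk one≡0 kk≡k-1 j j′ j′≡1+j pj≡one pj′≡kk n π =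
  mk⇔ (contraposition contains⇐) (contraposition contains⇒)
  where
  j<j′ : j < j′
  j<j′ = subst (λ m → toℕ j ℕ.< m) (sym j′≡1+j) (n<1+n (toℕ j))

  one<kk : one < kk
  one<kk = subst₂ ℕ._<_ (sym one≡0) (sym kk≡k-1) (m<n⇒0<n∸m 2≤k)

  p⁻¹one≡j : p ⟨$⟩ˡ one ≡ j
  p⁻¹one≡j = trans (cong (p ⟨$⟩ˡ_) (sym pj≡one)) (inverseˡ p)

  p⁻¹kk≡j′ : p ⟨$⟩ˡ kk ≡ j′
  p⁻¹kk≡j′ = trans (cong (p ⟨$⟩ˡ_) (sym pj′≡kk)) (inverseˡ p)

  contains⇒ : ContainsBR p j j′ π → ContainsBR (flip p) one kk (flip π)
  contains⇒ c = subst₂ (λ a b → ContainsBR (flip p) a b (flip π)) pj≡one pj′≡kk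
    (containsBR-flip p π j<j′ c)

  contains⇐ : ContainsBR (flip p) one kk (flip π) → ContainsBR p j j′ π
  -- flip (flip p) and p have definitionally the same action.
  contains⇐ c = subst₂ (λ a b → ContainsBR p a b π) p⁻¹one≡j p⁻¹kk≡j′
    (containsBR-flip (flip p) (flip π) one<kk c)
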